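{- Let $t$ be an odd positive integer. Identify a $4$-subset $\{(x_0,0),(x_1,1),(x_2,2),(x_3,3)\}$ of $\mathbb{Z}_t\times\mathbb{Z}_4$ with $(x_0,x_1,x_2,x_3)\in\mathbb{Z}_t^4$, with addition coordinatewise modulo $t$ and sums of sets defined elementwise. Let $\mathcal{A}=\{(i,i,i,i):i\in\mathbb{Z}_t\}$, $\mathcal{B}=\{(i,0,i,0):i\in\mathbb{Z}_t\}$, $\mathcal{C}=\{(i,i,0,0):i\in\mathbb{Z}_t\}$, and $$\mathcal{L}_2=\{(i,i,0,0): 1\le i\le \tfrac{t-1}{2}\}+\mathcal{A}+\mathcal{B},\quad \mathcal{L}_3=\{(i,i,0,0): \tfrac{t+1}{2}\le i\le t-1\}+\mathcal{A}+\mathcal{B},$$ $$\mathcal{L}_4=\{(i,0,0,0): 7\le i\le \tfrac{t+11}{2}\}+\mathcal{A}+\mathcal{C},$$ where the integers $i$ are taken modulo $t$. Then: (1) each pair $\{(y,0),(z,1)\}$ and each pair $\{(y,2),(z,3)\}$, $y,z\in\mathbb{Z}_t$, is contained in exactly $\frac{t-1}{2}$ quadruples of $\mathcal{L}_2$; (2) each pair $\{(y,0),(z,3)\}$ and each pair $\{(y,1),(z,2)\}$, $y,z\in\mathbb{Z}_t$, is contained in exactly $\frac{t-1}{2}$ quadruples of $\mathcal{L}_3$; (3) each pair $\{(y,0),(z,2)\}$ and each pair $\{(y,1),(z,3)\}$, $y,z\in\mathbb{Z}_t$, is contained in exactly $\frac{t-1}{2}$ quadruples of $\mathcal{L}_4$.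 -}

module Defs where

open import Data.Nat using (ℕ; zero; suc; _+_; _∸_; _≤_; NonZero)
open import Data.Nat.DivMod using (_mod_; _/_)
open import Data.Fin using (Fin; toℕ)
open import Data.Vec using (Vec; []; _∷_; zipWith; lookup)
open import Data.List using (List; length)
open import Data.List.Membership.Propositional using (_∈_)
open import Data.List.Relation.Unary.Unique.Propositional using (Unique)
open import Data.Product using (Σ; ∃; ∃-syntax; _×_)
open import Function.Bundles using (_⇔_)
open import Relation.Binary.PropositionalEquality using (_≡_)

module _ (t : ℕ) .{{_ : NonZero t}} where

  infixl 6 _+ₜ_
  _+ₜ_ : Fin t → Fin t → Fin t
  a +ₜ b = (toℕ a + toℕ b) mod t

  [_] : ℕ → Fin t
  [ n ] = n mod t

  -- a 4-subset {(x0,0),(x1,1),(x2,2),(x3,3)} of ℤ_t × ℤ_4, as (x0,x1,x2,x3)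
  Quad : Set
  Quad = Vec (Fin t) 4

  infixl 6 _⊕_
  _⊕_ : Quad → Quad → Quad
  _⊕_ = zipWith _+ₜ_

  QSet : Set₁
  QSet = Quad → Set

  infixl 6 _⊞_
  _⊞_ : QSet → QSet → QSet
  (P ⊞ Q) q = ∃[ u ] ∃[ v ] (P u × Q v × q ≡ u ⊕ v)

  𝒜 : QSet
  𝒜 q = ∃[ i ] (q ≡ i ∷ i ∷ i ∷ i ∷ [])

  ℬ : QSet
  ℬ q = ∃[ i ] (q ≡ i ∷ [ 0 ] ∷ i ∷ [ 0 ] ∷ [])

  𝒞 : QSet
  𝒞 q = ∃[ i ] (q ≡ i ∷ i ∷ [ 0 ] ∷ [ 0 ] ∷ [])

  G₂ : QSet
  G₂ q = ∃[ i ] (1 ≤ i × i ≤ (t ∸ 1) / 2 × q ≡ [ i ] ∷ [ i ] ∷ [ 0 ] ∷ [ 0 ] ∷ [])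

  G₃ : QSet
  G₃ q = ∃[ i ] ((t + 1) / 2 ≤ i × i ≤ t ∸ 1 × q ≡ [ i ] ∷ [ i ] ∷ [ 0 ] ∷ [ 0 ] ∷ [])

  G₄ : QSet
  G₄ q = ∃[ i ] (7 ≤ i × i ≤ (t + 11) / 2 × q ≡ [ i ] ∷ [ 0 ] ∷ [ 0 ] ∷ [ 0 ] ∷ [])

  ℒ₂ ℒ₃ ℒ₄ : QSet
  ℒ₂ = G₂ ⊞ 𝒜 ⊞ ℬ
  ℒ₃ = G₃ ⊞ 𝒜 ⊞ ℬ
  ℒ₄ = G₄ ⊞ 𝒜 ⊞ 𝒞

  ContainsPair : Quad → Fin 4 → Fin t → Fin 4 → Fin t → Set
  ContainsPair q j y k z = lookup q j ≡ y × lookup q k ≡ z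

  HasCard : QSet → ℕ → Set
  HasCard S n = ∃[ xs ] (length xs ≡ n × Unique xs × (∀ q → (q ∈ xs) ⇔ S q))

  PairCount : QSet → Fin 4 → Fin t → Fin 4 → Fin t → ℕ → Set
  PairCount L j y k z n = HasCard (λ q → L q × ContainsPair q j y k z) n

-- Each of ℒ₂, ℒ₃, ℒ₄ consists of the quadruples γ(g) + a·(1,1,1,1) + β(b), where g runs
-- over (t−1)/2 consecutive residues and γ, β are fixed 0/1 patterns. Fixing the values y, z
-- at two coordinates j, k where β differs gives, for each g, two equations that determine
-- a and then b uniquely. Distinct g give distinct quadruples, since g is the difference of
-- two coordinates of the quadruple.
module Submission where

open import Defs
open import Level using (0ℓ)
open import Algebra.Bundles using (Group; AbelianGroup)
open import Algebra.Structures using (IsAbelianGroup)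
import Algebra.Properties.Group as GroupProperties
open import Data.Nat using (ℕ; suc; _+_; _*_; _∸_; _%_; _≤_; _<_; NonZero; s≤s; s≤s⁻¹; >-nonZero⁻¹)
open import Data.Nat.Properties
  using (+-comm; +-assoc; *-comm; +-identityʳ; m+[n∸m]≡n; m+n∸m≡n; <⇒≤; m≤m+n; +-monoʳ-<; ∸-monoˡ-<; m∸n≤m; ≤-trans)
open import Data.Nat.DivMod using (_/_; %-distribˡ-+; m<n⇒m%n≡m; n%n≡0; m≡m%n+[m/n]*n; m*n/n≡m; m/n≤m)
open import Data.Fin using (Fin; zero; suc; toℕ; fromℕ<)
open import Data.Fin.Patterns using (0F; 1F; 3F)
open import Data.Fin.Properties using (toℕ-injective; toℕ-fromℕ<; fromℕ<-cong; toℕ<n)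
open import Data.Vec using ([]; _∷_; lookup)
open import Data.List using (tabulate)
open import Data.List.Properties using (length-tabulate)
open import Data.List.Membership.Propositional.Properties using (∈-tabulate⁺; ∈-tabulate⁻)
open import Data.List.Relation.Unary.Unique.Propositional.Properties using (tabulate⁺)
open import Data.Product using (∃!; ∃-syntax; _×_; _,_; proj₁; proj₂; swap)
open import Function.Base using (_∘_)
open import Function.Bundles using (_⇔_; mk⇔)
import Function.Properties.Equivalence as ⇔
open import Relation.Binary.PropositionalEquality
  using (_≡_; refl; sym; trans; cong; cong₂; subst; isEquivalence; module ≡-Reasoning)

module _ {c ℓ} (G : Group c ℓ) where
  open Group G using (_≈_; _∙_; _\\_; ε; assoc; identityʳ; ∙-congˡ; setoid)
    renaming (sym to ≈-sym; trans to ≈-trans)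
  open GroupProperties G using (∙-cancelˡ; ∙-cancelʳ; \\-leftDividesˡ; y≈x\\z)
  open import Relation.Binary.Reasoning.Setoid setoid

  translate-determined : ∀ {g g′ a a′ b b′} →
    (g ∙ a) ∙ b ≈ (g′ ∙ a′) ∙ b′ → (ε ∙ a) ∙ b ≈ (ε ∙ a′) ∙ b′ → g ≈ g′
  translate-determined {g} {g′} {a} {a′} {b} {b′} eq eq₀ = ∙-cancelʳ (a ∙ b) g g′ (begin
      g ∙ (a ∙ b)     ≈⟨ assoc g a b ⟨
      (g ∙ a) ∙ b     ≈⟨ eq ⟩
      (g′ ∙ a′) ∙ b′  ≈⟨ assoc g′ a′ b′ ⟩
      g′ ∙ (a′ ∙ b′)  ≈⟨ ∙-congˡ ab≈a′b′ ⟨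
      g′ ∙ (a ∙ b)    ∎)
    where
      ab≈a′b′ : a ∙ b ≈ a′ ∙ b′
      ab≈a′b′ = ∙-cancelˡ ε (a ∙ b) (a′ ∙ b′) (≈-trans (≈-sym (assoc ε a b)) (≈-trans eq₀ (assoc ε a′ b′)))

  -- On a translate, the coordinate where β vanishes reads (x′ ∙ a) ∙ ε and fixes a; the other
  -- reads (x ∙ a) ∙ b and then fixes b.
  offsets-solution : ∀ x x′ y z →
    (x ∙ (x′ \\ z)) ∙ ((x ∙ (x′ \\ z)) \\ y) ≈ y × (x′ ∙ (x′ \\ z)) ∙ ε ≈ z
  offsets-solution x x′ y z = \\-leftDividesˡ (x ∙ (x′ \\ z)) y , ≈-trans (identityʳ _) (\\-leftDividesˡ x′ z)

  offsets-solution-unique : ∀ {x x′ y z a b} →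
    (x ∙ a) ∙ b ≈ y → (x′ ∙ a) ∙ ε ≈ z → a ≈ x′ \\ z × b ≈ (x ∙ a) \\ y
  offsets-solution-unique eq eq′ = y≈x\\z _ _ _ (≈-trans (≈-sym (identityʳ _)) eq′) , y≈x\\z _ _ _ eq

module _ (t : ℕ) .{{_ : NonZero t}} where
  open ≡-Reasoning

  private
    infixl 6 _⊹_
    _⊹_ : Fin t → Fin t → Fin t
    _⊹_ = _+ₜ_ t

    ⟦_⟧ : ℕ → Fin t
    ⟦_⟧ = [_] t

  toℕ-[] : ∀ n → toℕ ⟦ n ⟧ ≡ n % t
  toℕ-[] n = toℕ-fromℕ< _

  []-cong-% : ∀ {m n} → m % t ≡ n % t → ⟦ m ⟧ ≡ ⟦ n ⟧
  []-cong-% eq = fromℕ<-cong _ _ eq _ _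

  []-injective-< : ∀ {m n} → m < t → n < t → ⟦ m ⟧ ≡ ⟦ n ⟧ → m ≡ n
  []-injective-< {m} {n} m<t n<t eq = begin
    m          ≡⟨ m<n⇒m%n≡m m<t ⟨
    m % t      ≡⟨ toℕ-[] m ⟨
    toℕ ⟦ m ⟧  ≡⟨ cong toℕ eq ⟩
    toℕ ⟦ n ⟧  ≡⟨ toℕ-[] n ⟩
    n % t      ≡⟨ m<n⇒m%n≡m n<t ⟩
    n          ∎

  []-toℕ : ∀ i → ⟦ toℕ i ⟧ ≡ i
  []-toℕ i = toℕ-injective (trans (toℕ-[] (toℕ i)) (m<n⇒m%n≡m (toℕ<n i)))

  []-homo-+ : ∀ m n → ⟦ m + n ⟧ ≡ ⟦ m ⟧ ⊹ ⟦ n ⟧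
  []-homo-+ m n = []-cong-% (begin
    (m + n) % t                  ≡⟨ %-distribˡ-+ m n t ⟩
    (m % t + n % t) % t          ≡⟨ cong₂ (λ u v → (u + v) % t) (toℕ-[] m) (toℕ-[] n) ⟨
    (toℕ ⟦ m ⟧ + toℕ ⟦ n ⟧) % t  ∎)

  -ₜ_ : Fin t → Fin t
  -ₜ a = ⟦ t ∸ toℕ a ⟧

  +ₜ-comm : ∀ a b → a ⊹ b ≡ b ⊹ a
  +ₜ-comm a b = cong ⟦_⟧ (+-comm (toℕ a) (toℕ b))

  +ₜ-assoc : ∀ a b c → (a ⊹ b) ⊹ c ≡ a ⊹ (b ⊹ c)
  +ₜ-assoc a b c = begin
    (a ⊹ b) ⊹ c                     ≡⟨ cong ((a ⊹ b) ⊹_) ([]-toℕ c) ⟨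
    ⟦ toℕ a + toℕ b ⟧ ⊹ ⟦ toℕ c ⟧   ≡⟨ []-homo-+ (toℕ a + toℕ b) (toℕ c) ⟨
    ⟦ toℕ a + toℕ b + toℕ c ⟧       ≡⟨ cong ⟦_⟧ (+-assoc (toℕ a) (toℕ b) (toℕ c)) ⟩
    ⟦ toℕ a + (toℕ b + toℕ c) ⟧     ≡⟨ []-homo-+ (toℕ a) (toℕ b + toℕ c) ⟩
    ⟦ toℕ a ⟧ ⊹ (b ⊹ c)             ≡⟨ cong (_⊹ (b ⊹ c)) ([]-toℕ a) ⟩
    a ⊹ (b ⊹ c)                     ∎

  +ₜ-identityˡ : ∀ a → ⟦ 0 ⟧ ⊹ a ≡ a
  +ₜ-identityˡ a = begin
    ⟦ 0 ⟧ ⊹ a          ≡⟨ cong (⟦ 0 ⟧ ⊹_) ([]-toℕ a) ⟨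
    ⟦ 0 ⟧ ⊹ ⟦ toℕ a ⟧  ≡⟨ []-homo-+ 0 (toℕ a) ⟨
    ⟦ toℕ a ⟧          ≡⟨ []-toℕ a ⟩
    a                  ∎

  +ₜ-inverseʳ : ∀ a → a ⊹ (-ₜ a) ≡ ⟦ 0 ⟧
  +ₜ-inverseʳ a = begin
    a ⊹ (-ₜ a)                     ≡⟨ cong (_⊹ (-ₜ a)) ([]-toℕ a) ⟨
    ⟦ toℕ a ⟧ ⊹ ⟦ t ∸ toℕ a ⟧      ≡⟨ []-homo-+ (toℕ a) (t ∸ toℕ a) ⟨
    ⟦ toℕ a + (t ∸ toℕ a) ⟧        ≡⟨ cong ⟦_⟧ (m+[n∸m]≡n (<⇒≤ (toℕ<n a))) ⟩
    ⟦ t ⟧                          ≡⟨ []-cong-% (trans (n%n≡0 t) (sym (m<n⇒m%n≡m (>-nonZero⁻¹ t)))) ⟩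
    ⟦ 0 ⟧                          ∎

  +ₜ-isAbelianGroup : IsAbelianGroup _≡_ _⊹_ ⟦ 0 ⟧ -ₜ_
  +ₜ-isAbelianGroup = record
    { isGroup = record
      { isMonoid = record
        { isSemigroup = record
          { isMagma = record { isEquivalence = isEquivalence ; ∙-cong = cong₂ _⊹_ }
          ; assoc = +ₜ-assoc
          }
        ; identity = +ₜ-identityˡ , λ a → trans (+ₜ-comm a _) (+ₜ-identityˡ a)
        }
      ; inverse = (λ a → trans (+ₜ-comm (-ₜ a) a) (+ₜ-inverseʳ a)) , +ₜ-inverseʳ
      ; ⁻¹-cong = cong -ₜ_
      }
    ; comm = +ₜ-comm
    }

  +ₜ-abelianGroup : AbelianGroup 0ℓ 0ℓ
  +ₜ-abelianGroup = record { isAbelianGroup = +ₜ-isAbelianGroup }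

hasCard-tabulate : ∀ {t n} .{{_ : NonZero t}} {S : QSet t} (F : Fin n → Quad t) →
  (∀ {k k′} → F k ≡ F k′ → k ≡ k′) → (∀ q → S q ⇔ (∃[ k ] q ≡ F k)) → HasCard t S n
hasCard-tabulate F F-injective S⇔image =
  tabulate F , length-tabulate F , tabulate⁺ F-injective ,
  λ q → ⇔.trans (mk⇔ ∈-tabulate⁻ λ { (k , refl) → ∈-tabulate⁺ k }) (⇔.sym (S⇔image q))

offset-in-range : ∀ {lo hi n} → suc hi ≡ lo + n → (k : Fin n) → lo ≤ lo + toℕ k × lo + toℕ k ≤ hi
offset-in-range {lo} size k =
  m≤m+n lo (toℕ k) , s≤s⁻¹ (subst (lo + toℕ k <_) (sym size) (+-monoʳ-< lo (toℕ<n k)))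

range-offset : ∀ {lo hi n i} → suc hi ≡ lo + n → lo ≤ i → i ≤ hi → ∃[ k ] i ≡ lo + toℕ {n} k
range-offset {lo} {n = n} {i} size lo≤i i≤hi = fromℕ< i∸lo<n , (begin
    i                  ≡⟨ m+[n∸m]≡n lo≤i ⟨
    lo + (i ∸ lo)      ≡⟨ cong (lo +_) (toℕ-fromℕ< i∸lo<n) ⟨
    lo + toℕ (fromℕ< i∸lo<n) ∎)
  where
    open ≡-Reasoning
    i∸lo<n : i ∸ lo < n
    i∸lo<n = subst (i ∸ lo <_) (m+n∸m≡n lo n) (∸-monoˡ-< (subst (i <_) size (s≤s i≤hi)) lo≤i)

module _ (t : ℕ) .{{_ : NonZero t}} where
  open AbelianGroup (+ₜ-abelianGroup t) using (_∙_; ε; group)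
  open Group group using (_\\_)
  open GroupProperties group using (∙-cancelˡ)

  offset-injective : ∀ lo {n} → n ≤ t → ∀ {k k′ : Fin n} → [_] t (lo + toℕ k) ≡ [_] t (lo + toℕ k′) → k ≡ k′
  offset-injective lo n≤t {k} {k′} eq = toℕ-injective ([]-injective-< t
    (≤-trans (toℕ<n k) n≤t) (≤-trans (toℕ<n k′) n≤t)
    (∙-cancelˡ ([_] t lo) _ _ (trans (sym ([]-homo-+ t lo (toℕ k))) (trans eq ([]-homo-+ t lo (toℕ k′))))))

  offsets-∃! : ∀ x x′ y z → ∃! _≡_ (λ (a , b) → (x ∙ a) ∙ b ≡ y × (x′ ∙ a) ∙ ε ≡ z)
  offsets-∃! x x′ y z = (x′ \\ z , (x ∙ (x′ \\ z)) \\ y) , offsets-solution group x x′ y z , unique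
    where
      unique : ∀ {s} → (x ∙ proj₁ s) ∙ proj₂ s ≡ y × (x′ ∙ proj₁ s) ∙ ε ≡ z →
               (x′ \\ z , (x ∙ (x′ \\ z)) \\ y) ≡ s
      unique {a , b} (eq , eq′) with offsets-solution-unique group {a = a} {b = b} eq eq′
      ... | refl , refl = refl

  𝟙₀ 𝟙₀₁ 𝟙₀₂ 𝟙₀₁₂₃ : Fin t → Quad t
  𝟙₀ a = a ∷ ε ∷ ε ∷ ε ∷ []
  𝟙₀₁ a = a ∷ a ∷ ε ∷ ε ∷ []
  𝟙₀₂ a = a ∷ ε ∷ a ∷ ε ∷ []
  𝟙₀₁₂₃ a = a ∷ a ∷ a ∷ a ∷ []

  Range : ℕ → ℕ → (Fin t → Quad t) → QSet t
  Range lo hi γ q = ∃[ i ] (lo ≤ i × i ≤ hi × q ≡ γ ([_] t i))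

  Span : (Fin t → Quad t) → QSet t
  Span β q = ∃[ b ] (q ≡ β b)

  -- ℒ₂ and ℒ₃ unfold to Translates lo hi 𝟙₀₁ 𝟙₀₂, and ℒ₄ to Translates 7 ((t + 11) / 2) 𝟙₀ 𝟙₀₁.
  Translates : ℕ → ℕ → (γ β : Fin t → Quad t) → QSet t
  Translates lo hi γ β = _⊞_ t (_⊞_ t (Range lo hi γ) (Span 𝟙₀₁₂₃)) (Span β)

  translate : (γ β : Fin t → Quad t) → Fin t → Fin t × Fin t → Quad t
  translate γ β g (a , b) = _⊕_ t (_⊕_ t (γ g) (𝟙₀₁₂₃ a)) (β b)

  Solvable : (γ β : Fin t → Quad t) → Fin 4 → Fin t → Fin 4 → Fin t → Set
  Solvable γ β j y k z = ∀ g → ∃! _≡_ (λ s → ContainsPair t (translate γ β g s) j y k z)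

  translates-pairCount : ∀ lo hi n → suc hi ≡ lo + n → n ≤ t → (γ β : Fin t → Quad t) →
    (∀ {g g′ s s′} → translate γ β g s ≡ translate γ β g′ s′ → g ≡ g′) →
    ∀ {j y k z} → Solvable γ β j y k z →
    PairCount t (Translates lo hi γ β) j y k z n
  translates-pairCount lo hi n size n≤t γ β determined {j} {y} {k} {z} solvable =
    hasCard-tabulate F (offset-injective lo n≤t ∘ determined) λ q → mk⇔ (to q) from
    where
      generator : Fin n → Fin t
      generator m = [_] t (lo + toℕ m)

      F : Fin n → Quad t
      F m = translate γ β (generator m) (proj₁ (solvable (generator m)))

      translate∈Translates : ∀ m s → Translates lo hi γ β (translate γ β (generator m) s)
      translate∈Translates m (a , b) with offset-in-range size m
      ... | lo≤i , i≤hi =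
        _ , _ , (_ , _ , (lo + toℕ m , lo≤i , i≤hi , refl) , (a , refl) , refl) , (b , refl) , refl

      to : ∀ q → Translates lo hi γ β q × ContainsPair t q j y k z → ∃[ m ] q ≡ F m
      to _ ((_ , _ , (_ , _ , (i , lo≤i , i≤hi , refl) , (a , refl) , refl) , (b , refl) , refl) , contains)
        with range-offset size lo≤i i≤hi
      ... | m , refl =
        m , sym (cong (translate γ β (generator m)) (proj₂ (proj₂ (solvable (generator m))) contains))

      from : ∀ {q} → ∃[ m ] q ≡ F m → Translates lo hi γ β q × ContainsPair t q j y k z
      from (m , refl) = translate∈Translates m _ , proj₁ (proj₂ (solvable (generator m)))

  𝟙₀₁-determined : ∀ {g g′ s s′} → translate 𝟙₀₁ 𝟙₀₂ g s ≡ translate 𝟙₀₁ 𝟙₀₂ g′ s′ → g ≡ g′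
  𝟙₀₁-determined eq = translate-determined group (cong (λ q → lookup q 1F) eq) (cong (λ q → lookup q 3F) eq)

  𝟙₀-determined : ∀ {g g′ s s′} → translate 𝟙₀ 𝟙₀₁ g s ≡ translate 𝟙₀ 𝟙₀₁ g′ s′ → g ≡ g′
  𝟙₀-determined eq = translate-determined group (cong (λ q → lookup q 0F) eq) (cong (λ q → lookup q 1F) eq)

∃!-swap : ∀ {A : Set} {P Q : A → Set} → ∃! _≡_ (λ s → P s × Q s) → ∃! _≡_ (λ s → Q s × P s)
∃!-swap (s , (p , q) , unique) = s , (q , p) , unique ∘ swap

odd⇒suc-double : ∀ {t} → t % 2 ≡ 1 → ∃[ m ] t ≡ suc (m * 2)
odd⇒suc-double {t} odd = t / 2 , trans (m≡m%n+[m/n]*n t 2) (cong (_+ t / 2 * 2) odd)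

upper-half-size : ∀ t → t % 2 ≡ 1 → suc (t ∸ 1) ≡ (t + 1) / 2 + (t ∸ 1) / 2
upper-half-size t odd with odd⇒suc-double {t} odd
... | m , refl = begin
    suc (m * 2)                        ≡⟨ cong suc (*-comm m 2) ⟩
    suc (m + (m + 0))                  ≡⟨ cong (λ w → suc (m + w)) (+-identityʳ m) ⟩
    suc m + m                          ≡⟨ cong₂ _+_ (m*n/n≡m (suc m) 2) (m*n/n≡m m 2) ⟨
    suc m * 2 / 2 + m * 2 / 2          ≡⟨ cong (λ w → w / 2 + m * 2 / 2) (+-comm 1 (suc (m * 2))) ⟩
    (suc (m * 2) + 1) / 2 + m * 2 / 2  ∎
  where open ≡-Reasoning

shifted-half-size : ∀ t → t % 2 ≡ 1 → suc ((t + 11) / 2) ≡ 7 + (t ∸ 1) / 2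
shifted-half-size t odd with odd⇒suc-double {t} odd
... | m , refl = begin
    suc ((suc (m * 2) + 11) / 2)  ≡⟨ cong (λ w → suc (w / 2)) (+-comm (suc (m * 2)) 11) ⟩
    suc ((6 + m) * 2 / 2)         ≡⟨ cong suc (m*n/n≡m (6 + m) 2) ⟩
    7 + m                         ≡⟨ cong (7 +_) (m*n/n≡m m 2) ⟨
    7 + m * 2 / 2                 ∎
  where open ≡-Reasoning

half≤ : ∀ t → (t ∸ 1) / 2 ≤ t
half≤ t = ≤-trans (m/n≤m (t ∸ 1) 2) (m∸n≤m t 1)

lemma23 : (t : ℕ) .{{_ : NonZero t}} → t % 2 ≡ 1 →
    ((y z : Fin t) →
       PairCount t (ℒ₂ t) zero y (suc zero) z ((t ∸ 1) / 2) × PairCount t (ℒ₂ t) (suc (suc zero)) y (suc (suc (suc zero))) z ((t ∸ 1) / 2)) ×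
    ((y z : Fin t) →
       PairCount t (ℒ₃ t) zero y (suc (suc (suc zero))) z ((t ∸ 1) / 2) × PairCount t (ℒ₃ t) (suc zero) y (suc (suc zero)) z ((t ∸ 1) / 2)) ×
    ((y z : Fin t) →
       PairCount t (ℒ₄ t) zero y (suc (suc zero)) z ((t ∸ 1) / 2) × PairCount t (ℒ₄ t) (suc zero) y (suc (suc (suc zero))) z ((t ∸ 1) / 2))
lemma23 t odd =
    (λ y z → ℒ₂₃-pairCount 1 _ refl (λ g → offsets-∃! t g g y z)
           , ℒ₂₃-pairCount 1 _ refl (λ _ → offsets-∃! t 0ₜ 0ₜ y z))
  , (λ y z → ℒ₂₃-pairCount _ _ (upper-half-size t odd) (λ g → offsets-∃! t g 0ₜ y z)
           , ℒ₂₃-pairCount _ _ (upper-half-size t odd) (λ g → ∃!-swap (offsets-∃! t 0ₜ g z y)))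
  , (λ y z → ℒ₄-pairCount 7 _ (shifted-half-size t odd) (λ g → offsets-∃! t g 0ₜ y z)
           , ℒ₄-pairCount 7 _ (shifted-half-size t odd) (λ _ → offsets-∃! t 0ₜ 0ₜ y z))
  where
    0ₜ : Fin t
    0ₜ = [_] t 0

    ℒ₂₃-pairCount : ∀ lo hi → suc hi ≡ lo + (t ∸ 1) / 2 →
      ∀ {j y k z} → Solvable t (𝟙₀₁ t) (𝟙₀₂ t) j y k z →
      PairCount t (Translates t lo hi (𝟙₀₁ t) (𝟙₀₂ t)) j y k z ((t ∸ 1) / 2)
    ℒ₂₃-pairCount lo hi size =
      translates-pairCount t lo hi _ size (half≤ t) (𝟙₀₁ t) (𝟙₀₂ t) (𝟙₀₁-determined t)

    ℒ₄-pairCount : ∀ lo hi → suc hi ≡ lo + (t ∸ 1) / 2 →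
      ∀ {j y k z} → Solvable t (𝟙₀ t) (𝟙₀₁ t) j y k z →
      PairCount t (Translates t lo hi (𝟙₀ t) (𝟙₀₁ t)) j y k z ((t ∸ 1) / 2)
    ℒ₄-pairCount lo hi size =
      translates-pairCount t lo hi _ size (half≤ t) (𝟙₀ t) (𝟙₀₁ t) (𝟙₀-determined t)
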